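{- Let $n \ge 2$, let $l$ be a non-decreasing integer-valued sequence with $l(1) = 2^{n-1}$ and $l(k+1)-l(k) \in \{\sum_{i=1}^{b}2^{n-i} : 1 \le b \le n\}$ for all $k$, and let $D_1 = \{l(k)\}_{k=1}^\infty$ and $D_j = D_1 \pm 2^{n-2}\pm\cdots\pm 2^{n-j}$ for $2 \le j \le n$. Then $\bigcup_{j=1}^n D_j$ is the set of all positive integers.
   Context: For a set $X$ of integers and an integer $r$, $X \pm r = \{x+r : x\in X\}\cup\{x-r : x \in X\}$, iterated left to right. -}

module Defs where

open import Data.Nat as ℕ using (ℕ; zero; suc; _∸_; _^_)
open import Data.Integer using (ℤ; +_; _+_; _-_; _≤_; _>_)
open import Data.Product using (Σ; ∃; _×_; _,_)
open import Data.Sum using (_⊎_)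
open import Data.Empty using (⊥)
open import Relation.Binary.PropositionalEquality using (_≡_)

ℤSet : Set₁
ℤSet = ℤ → Set

_±_ : ℤSet → ℤ → ℤSet
(X ± r) m = (∃ λ x → X x × m ≡ x + r) ⊎ (∃ λ x → X x × m ≡ x - r)

geomSum : ℕ → ℕ → ℕ
geomSum n zero = 0
geomSum n (suc b) = geomSum n b ℕ.+ 2 ^ (n ∸ suc b)

Gap : ℕ → ℤ → Set
Gap n d = ∃ λ b → 1 ℕ.≤ b × b ℕ.≤ n × d ≡ + geomSum n b

-- D₁ = { l(k) : k ≥ 1 } (sequence indexed from 1; l 0 is ignored)
-- D j = D₁ ± 2^(n-2) ± ... ± 2^(n-j), iterated left to right.
D : ℕ → (ℕ → ℤ) → ℕ → ℤSet
D n l zero = λ _ → ⊥   -- unused (j ranges over 1..n)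
D n l (suc zero) m = ∃ λ k → 1 ℕ.≤ k × m ≡ l k
D n l (suc (suc j)) = D n l (suc j) ± (+ (2 ^ (n ∸ suc (suc j))))

module Submission where

-- Proof idea.  Write H = 2^(n-1) and Near b x y for |y - x| < b.
--
-- Soundness (every covered integer is positive): D₁ ⊆ [H, ∞) because l is
-- nondecreasing from l(1) = H, and each further level halves the lower bound,
-- since x ≥ 2h implies x ± h ≥ h.  So D_{j} ⊆ [2^(n-j), ∞) ⊆ [1, ∞).
--
-- Completeness (every positive integer is covered):
--   (1) every gap Σ_{i≤b} 2^(n-i) lies strictly between 0 and 2^n = 2H, so the
--       radius-H windows around the terms l(k) leave no positive integer out
--       (lemma `nearby`, stated for an arbitrary integer sequence);
--   (2) from a point x ∈ D_{j+1}, every y with |y - x| < 2^(n-j-1) is obtained by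
--       moving ±2^(n-j-2), ±2^(n-j-3), … towards y, stopping when y is hit; this
--       signed binary expansion (lemma `expand`) puts y in some D_{j'} with j' ≤ n.
-- The theorem combines (1) with (2) at level j = 1.

open import Defs
open import Data.Nat as ℕ using (ℕ; zero; suc; _∸_; _^_; z≤n; s≤s)
import Data.Nat.Properties as ℕP
open import Data.Integer using (ℤ; +_; +[1+_]; _+_; _-_; -_; _≤_; _<_; _>_; 0ℤ; 1ℤ; +<+)
import Data.Integer.Properties as ℤP
open import Data.Integer.Tactic.RingSolver using (solve-∀)
open import Data.Product using (∃; _×_; _,_; proj₁; proj₂)
open import Data.Sum using (inj₁; inj₂)
open import Function.Bundles using (_⇔_; mk⇔)
open import Relation.Binary.Definitions using (tri<; tri≈; tri>)
open import Relation.Binary.PropositionalEquality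
  using (_≡_; refl; sym; trans; cong; cong₂; subst; module ≡-Reasoning)
open import Relation.Nullary using (¬_; contradiction)

pow2 : ℕ → ℤ
pow2 r = + (2 ^ r)

pow2-pos : ∀ r → 0ℤ < pow2 r
pow2-pos r = +<+ (ℕP.m^n>0 2 r)

pow-halve : ∀ n i → i ℕ.< n → 2 ^ (n ∸ i) ≡ 2 ^ (n ∸ suc i) ℕ.+ 2 ^ (n ∸ suc i)
pow-halve (suc n) zero    _         = cong (2 ^ n ℕ.+_) (ℕP.+-identityʳ (2 ^ n))
pow-halve (suc n) (suc i) (s≤s i<n) = pow-halve n i i<n

pow2-double : ∀ r → pow2 (suc r) ≡ pow2 r + pow2 r
pow2-double r = trans (cong +_ (pow-halve (suc r) 0 (s≤s z≤n))) (ℤP.pos-+ (2 ^ r) (2 ^ r))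

offset : ∀ {n} i r → i ℕ.+ r ≡ n → n ∸ i ≡ r
offset i r refl = ℕP.m+n∸m≡n i r

geomSum-complement : ∀ n b → b ℕ.≤ n → geomSum n b ℕ.+ 2 ^ (n ∸ b) ≡ 2 ^ n
geomSum-complement n zero    _   = refl
geomSum-complement n (suc b) b<n = begin
  geomSum n b ℕ.+ h ℕ.+ h     ≡⟨ ℕP.+-assoc (geomSum n b) h h ⟩
  geomSum n b ℕ.+ (h ℕ.+ h)   ≡⟨ cong (geomSum n b ℕ.+_) (sym (pow-halve n b b<n)) ⟩
  geomSum n b ℕ.+ 2 ^ (n ∸ b) ≡⟨ geomSum-complement n b (ℕP.<⇒≤ b<n) ⟩
  2 ^ n                        ∎
  where
    open ≡-Reasoning
    h : ℕ
    h = 2 ^ (n ∸ suc b)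

gap-bounds : ∀ n {d} → 1 ℕ.≤ n → Gap n d → 0ℤ < d × d < pow2 (n ∸ 1) + pow2 (n ∸ 1)
gap-bounds n n≥1 (suc b , _ , b<n , refl) = +<+ positive , upper
  where
    g : ℕ
    g = geomSum n (suc b)
    positive : 0 ℕ.< g
    positive = ℕP.<-≤-trans (ℕP.m^n>0 2 (n ∸ suc b)) (ℕP.m≤n+m _ (geomSum n b))
    below : g ℕ.< 2 ^ (n ∸ 1) ℕ.+ 2 ^ (n ∸ 1)
    below = subst (g ℕ.<_) (trans (geomSum-complement n (suc b) b<n) (pow-halve n 0 n≥1))
              (ℕP.m<m+n g (ℕP.m^n>0 2 (n ∸ suc b)))
    upper : + g < pow2 (n ∸ 1) + pow2 (n ∸ 1)
    upper = subst (+ g <_) (ℤP.pos-+ (2 ^ (n ∸ 1)) (2 ^ (n ∸ 1))) (+<+ below)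

difference-bounds : ∀ {a b c} → 0ℤ < b - a → b - a < c → a < b × b < a + c
difference-bounds {a} {b} {c} pos upper = lower , upper'
  where
    a+[b-a]≡b : ∀ a b → a + (b - a) ≡ b
    a+[b-a]≡b = solve-∀
    open ℤP.≤-Reasoning
    lower : a < b
    lower = begin-strict
      a           ≡⟨ ℤP.+-identityʳ a ⟨
      a + 0ℤ      <⟨ ℤP.+-monoʳ-< a pos ⟩
      a + (b - a) ≡⟨ a+[b-a]≡b a b ⟩
      b           ∎
    upper' : b < a + c
    upper' = begin-strict
      b           ≡⟨ a+[b-a]≡b a b ⟨
      a + (b - a) <⟨ ℤP.+-monoʳ-< a upper ⟩
      a + c       ∎

first-is-least : ∀ (s : ℕ → ℤ) → (∀ k → 1 ℕ.≤ k → s k ≤ s (suc k)) →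
                 ∀ k → 1 ℕ.≤ k → s 1 ≤ s k
first-is-least s mono (suc zero)    _ = ℤP.≤-refl
first-is-least s mono (suc (suc k)) _ =
  ℤP.≤-trans (first-is-least s mono (suc k) (s≤s z≤n)) (mono (suc k) (s≤s z≤n))

Near : ℤ → ℤ → ℤ → Set
Near b x y = x - b < y × y < x + b

near-one : ∀ {x y} → Near 1ℤ x y → y ≡ x
near-one {x} {y} (lo , hi) = sym (ℤP.≤∧≮⇒≡ x≤y x≮y)
  where
    suc[x-1]≡x : ∀ x → 1ℤ + (x - 1ℤ) ≡ x
    suc[x-1]≡x = solve-∀
    x≤y : x ≤ y
    x≤y = subst (_≤ y) (suc[x-1]≡x x) (ℤP.i<j⇒suc[i]≤j lo)
    x≮y : ¬ x < y
    x≮y x<y = ℤP.≤⇒≯ (ℤP.i<j⇒suc[i]≤j x<y) (subst (y <_) (ℤP.+-comm x 1ℤ) hi)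

one-near-pow2 : ∀ r → Near (pow2 r) (pow2 r) 1ℤ
one-near-pow2 r = subst (_< 1ℤ) (sym (ℤP.+-inverseʳ (pow2 r))) (+<+ (s≤s z≤n)) ,
  subst (1ℤ <_) (ℤP.pos-+ (2 ^ r) (2 ^ r)) (+<+ (ℕP.+-mono-≤ (ℕP.m^n>0 2 r) (ℕP.m^n>0 2 r)))

near-halve : ∀ r {x y} → Near (pow2 (suc r)) x y → Near (pow2 r + pow2 r) x y
near-halve r {x} {y} = subst (λ b → Near b x y) (pow2-double r)

near-below : ∀ h {x y} → Near (h + h) x y → y < x → Near h (x - h) y
near-below h {x} {y} (lo , _) y<x = lower , upper
  where
    open ℤP.≤-Reasoning
    x-h-h≡x-2h : ∀ x h → x - h - h ≡ x - (h + h)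
    x-h-h≡x-2h = solve-∀
    x-h+h≡x : ∀ x h → x - h + h ≡ x
    x-h+h≡x = solve-∀
    lower : x - h - h < y
    lower = begin-strict x - h - h ≡⟨ x-h-h≡x-2h x h ⟩ x - (h + h) <⟨ lo ⟩ y ∎
    upper : y < x - h + h
    upper = begin-strict y <⟨ y<x ⟩ x ≡⟨ x-h+h≡x x h ⟨ x - h + h ∎

near-above : ∀ h {x y} → Near (h + h) x y → x < y → Near h (x + h) y
near-above h {x} {y} (_ , hi) x<y = lower , upper
  where
    open ℤP.≤-Reasoning
    x+h-h≡x : ∀ x h → x + h - h ≡ x
    x+h-h≡x = solve-∀
    x+h+h≡x+2h : ∀ x h → x + h + h ≡ x + (h + h)
    x+h+h≡x+2h = solve-∀
    lower : x + h - h < y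
    lower = begin-strict x + h - h ≡⟨ x+h-h≡x x h ⟩ x <⟨ x<y ⟩ y ∎
    upper : y < x + h + h
    upper = begin-strict y <⟨ hi ⟩ x + (h + h) ≡⟨ x+h+h≡x+2h x h ⟨ x + h + h ∎

near-next : ∀ H {x x'} → x < x' → x' < x + (H + H) → Near H x' (x + H)
near-next H {x} {x'} x<x' x'<x+2H = lower , upper
  where
    open ℤP.≤-Reasoning
    x+2H-H≡x+H : ∀ x H → x + (H + H) - H ≡ x + H
    x+2H-H≡x+H = solve-∀
    lower : x' - H < x + H
    lower = begin-strict
      x' - H            <⟨ ℤP.+-monoˡ-< (- H) x'<x+2H ⟩
      x + (H + H) - H   ≡⟨ x+2H-H≡x+H x H ⟩
      x + H             ∎
    upper : x + H < x' + H
    upper = ℤP.+-monoˡ-< H x<x'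

-- Covering lemma: if the window of radius H around s(1) contains 1, and
-- consecutive terms increase by less than 2H, then every positive integer lies
-- in the window around some term s(k), k ≥ 1.  The proof walks up the integers,
-- moving to the next term exactly when the current window is left.
nearby : ∀ (s : ℕ → ℤ) (H : ℤ) → Near H (s 1) 1ℤ →
         (∀ k → 1 ℕ.≤ k → s k < s (suc k) × s (suc k) < s k + (H + H)) →
         ∀ a → ∃ λ k → 1 ℕ.≤ k × Near H (s k) +[1+ a ]
nearby s H start steps zero = 1 , s≤s z≤n , start
nearby s H start steps (suc a) with nearby s H start steps a
... | k , k≥1 , (lo , hi) with ℤP.<-cmp +[1+ suc a ] (s k + H)
...   | tri< inside _ _ = k , k≥1 , ℤP.<-trans lo (+<+ ℕP.≤-refl) , inside
...   | tri≈ _ edge _   = suc k , s≤s z≤n ,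
      subst (Near H (s (suc k))) (sym edge) (near-next H (proj₁ (steps k k≥1)) (proj₂ (steps k k≥1)))
...   | tri> _ _ beyond = contradiction beyond (ℤP.≤⇒≯ (ℤP.i<j⇒suc[i]≤j hi))

module _ (n : ℕ) (l : ℕ → ℤ) where

  Covered : ℤ → Set
  Covered m = ∃ λ j → 1 ℕ.≤ j × j ℕ.≤ n × D n l j m

  step-size : ∀ j r → suc (suc j) ℕ.+ r ≡ n → + (2 ^ (n ∸ suc (suc j))) ≡ pow2 r
  step-size j r eq = cong pow2 (offset (suc (suc j)) r eq)

  next-level : ∀ j r → suc j ℕ.+ suc r ≡ n → suc (suc j) ℕ.+ r ≡ n
  next-level j r eq = trans (sym (ℕP.+-suc (suc j) r)) eq

  previous-level : ∀ j r → suc (suc j) ℕ.+ r ≡ n → suc j ℕ.+ suc r ≡ n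
  previous-level j r eq = trans (ℕP.+-suc (suc j) r) eq

  child-below : ∀ j r → suc j ℕ.+ suc r ≡ n →
                ∀ {x} → D n l (suc j) x → D n l (suc (suc j)) (x - pow2 r)
  child-below j r eq {x} x∈D =
    subst (λ h → D n l (suc (suc j)) (x - h)) (step-size j r (next-level j r eq)) (inj₂ (x , x∈D , refl))

  child-above : ∀ j r → suc j ℕ.+ suc r ≡ n →
                ∀ {x} → D n l (suc j) x → D n l (suc (suc j)) (x + pow2 r)
  child-above j r eq {x} x∈D =
    subst (λ h → D n l (suc (suc j)) (x + h)) (step-size j r (next-level j r eq)) (inj₁ (x , x∈D , refl))

  -- Lower bound: if D_1 ⊆ [2^(n-1), ∞), then D_{j+1} ⊆ [2^(n-j-1), ∞),
  -- because x ≥ 2h forces both x + h and x - h to be ≥ h.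
  D-lower : (∀ {x} → D n l 1 x → pow2 (n ∸ 1) ≤ x) →
            ∀ j r → suc j ℕ.+ r ≡ n → ∀ {m} → D n l (suc j) m → pow2 r ≤ m
  D-lower D₁-bound zero r eq m∈D = subst (λ e → pow2 e ≤ _) (offset 1 r eq) (D₁-bound m∈D)
  D-lower D₁-bound (suc j) r eq (inj₁ (x , x∈D , refl)) = begin
    pow2 r            ≤⟨ ℤP.i≤i+j (pow2 r) (pow2 r) ⟩
    pow2 r + pow2 r   ≡⟨ pow2-double r ⟨
    pow2 (suc r)      ≤⟨ D-lower D₁-bound j (suc r) (previous-level j r eq) x∈D ⟩
    x                 ≤⟨ ℤP.i≤i+j x _ ⟩
    x + + (2 ^ (n ∸ suc (suc j))) ∎
    where open ℤP.≤-Reasoning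
  D-lower D₁-bound (suc j) r eq (inj₂ (x , x∈D , refl)) = begin
    pow2 r                      ≡⟨ 2a-a≡a (pow2 r) ⟨
    pow2 r + pow2 r - pow2 r    ≡⟨ cong₂ _-_ (sym (pow2-double r)) (sym (step-size j r eq)) ⟩
    pow2 (suc r) - h            ≤⟨ ℤP.+-monoˡ-≤ (- h) x≥2h ⟩
    x - h                       ∎
    where
      open ℤP.≤-Reasoning
      h : ℤ
      h = + (2 ^ (n ∸ suc (suc j)))
      x≥2h : pow2 (suc r) ≤ x
      x≥2h = D-lower D₁-bound j (suc r) (previous-level j r eq) x∈D
      2a-a≡a : ∀ a → a + a - a ≡ a
      2a-a≡a = solve-∀

  here : ∀ j {r y} → suc j ℕ.+ r ≡ n → D n l (suc j) y → Covered y
  here j {r} eq y∈D = suc j , s≤s z≤n , subst (suc j ℕ.≤_) eq (ℕP.m≤m+n (suc j) r) , y∈D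

  -- Either y = x, or y lies on one side of
  -- x and the child x ∓ 2^(r-1) ∈ D_{j+2} is within 2^(r-1) of y.
  expand : ∀ r j → suc j ℕ.+ r ≡ n → ∀ {x y} → D n l (suc j) x → Near (pow2 r) x y → Covered y
  expand zero j eq x∈D near = here j eq (subst (D n l (suc j)) (sym (near-one near)) x∈D)
  expand (suc r) j eq {x} {y} x∈D near with ℤP.<-cmp y x
  ... | tri≈ _ y≡x _ = here j eq (subst (D n l (suc j)) (sym y≡x) x∈D)
  ... | tri< y<x _ _ =
    expand r (suc j) (next-level j r eq) (child-below j r eq x∈D)
      (near-below (pow2 r) (near-halve r {x} near) y<x)
  ... | tri> _ _ x<y =
    expand r (suc j) (next-level j r eq) (child-above j r eq x∈D)
      (near-above (pow2 r) (near-halve r {x} near) x<y)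

proposition2p16 : (n : ℕ) → 2 ℕ.≤ n → (l : ℕ → ℤ) →
    (∀ k → 1 ℕ.≤ k → l k ≤ l (suc k)) →
    l 1 ≡ + (2 ^ (n ∸ 1)) →
    (∀ k → 1 ℕ.≤ k → Gap n (l (suc k) - l k)) →
    ∀ (m : ℤ) → ((∃ λ j → 1 ℕ.≤ j × j ℕ.≤ n × D n l j m) ⇔ m > 0ℤ)
proposition2p16 n n≥2 l mono l₁ gap m = mk⇔ positive (covering m)
  where
    n≥1 : 1 ℕ.≤ n
    n≥1 = ℕP.≤-trans (s≤s z≤n) n≥2
    H : ℤ
    H = pow2 (n ∸ 1)

    D₁-bound : ∀ {x} → D n l 1 x → H ≤ x
    D₁-bound (k , k≥1 , refl) = subst (_≤ l k) l₁ (first-is-least l mono k k≥1)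

    positive : Covered n l m → m > 0ℤ
    positive (suc j , _ , j<n , m∈D) =
      ℤP.<-≤-trans (pow2-pos (n ∸ suc j))
        (D-lower n l D₁-bound j (n ∸ suc j) (ℕP.m+[n∸m]≡n j<n) m∈D)

    start : Near H (l 1) 1ℤ
    start = subst (λ c → Near H c 1ℤ) (sym l₁) (one-near-pow2 (n ∸ 1))

    steps : ∀ k → 1 ℕ.≤ k → l k < l (suc k) × l (suc k) < l k + (H + H)
    steps k k≥1 = let pos , upper = gap-bounds n n≥1 (gap k k≥1) in difference-bounds pos upper

    covering : ∀ m → m > 0ℤ → Covered n l m
    covering (+ zero) (+<+ ())
    covering +[1+ a ] _ = let k , k≥1 , near = nearby l H start steps a in
      expand n l (n ∸ 1) 0 (ℕP.m+[n∸m]≡n n≥1) (k , k≥1 , refl) near
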